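{- Let $t$ be a positive integer and let $i\in\{1,\ldots,t\}$. Then there exist a positive integer $k$ and matrices $A,M,N,B\in\mathbb{Z}^{k\times k}_{\rm uptr}$ such that \[AM^{a_1}NM^{a_2}N\cdots NM^{a_t}B=a_iE_k\] for all nonnegative integers $a_1,\ldots,a_t$.
   Context: $\mathbb{Z}^{k\times k}_{\rm uptr}$ is the set of upper-triangular $k\times k$ integer matrices. $E_k$ is the $k\times k$ matrix whose only nonzero entry is the entry in row $1$, column $k$, which equals $1$. $M^0$ is the identity matrix. -}

module Defs where

open import Data.Nat using (ℕ; zero; suc; _<_)
open import Data.Integer using (ℤ; _+_; _*_; 0ℤ; 1ℤ; _◃_)
open import Data.Fin using (Fin; zero; suc; toℕ; fromℕ)
open import Data.Vec using (Vec; []; _∷_)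
open import Relation.Binary.PropositionalEquality using (_≡_)
open import Data.Nat using () renaming (_≟_ to _≟ℕ_)
open import Relation.Nullary using (yes; no)

-- k × k integer matrices, as functions (row, column) ↦ entry
Mat : ℕ → Set
Mat k = Fin k → Fin k → ℤ

Σ : ∀ {k} → (Fin k → ℤ) → ℤ
Σ {zero}  f = 0ℤ
Σ {suc k} f = f zero + Σ (λ j → f (suc j))

_⊗_ : ∀ {k} → Mat k → Mat k → Mat k
(A ⊗ B) i j = Σ (λ l → A i l * B l j)
infixl 7 _⊗_

I : ∀ {k} → Mat k
I zero    zero    = 1ℤ
I zero    (suc j) = 0ℤ
I (suc i) zero    = 0ℤ
I (suc i) (suc j) = I i j

_^ᴹ_ : ∀ {k} → Mat k → ℕ → Mat k
M ^ᴹ zero  = I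
M ^ᴹ suc n = M ⊗ (M ^ᴹ n)

_·ᴹ_ : ∀ {k} → ℤ → Mat k → Mat k
(c ·ᴹ A) i j = c * A i j

UpperTriangular : ∀ {k} → Mat k → Set
UpperTriangular {k} A = ∀ (i j : Fin k) → toℕ j < toℕ i → A i j ≡ 0ℤ

-- E_k (k ≥ 1): only nonzero entry is 1 at row 1, column k
E : ∀ {k} → Mat (suc k)
E {k} zero j with toℕ j ≟ℕ k
... | yes _ = 1ℤ
... | no  _ = 0ℤ
E (suc i) j = 0ℤ

_≈ᴹ_ : ∀ {k} → Mat k → Mat k → Set
A ≈ᴹ B = ∀ i j → A i j ≡ B i j
infix 4 _≈ᴹ_

word : ∀ {k t} → Mat k → Mat k → Vec ℕ (suc t) → Mat k
word M N (a ∷ [])        = M ^ᴹ a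
word M N (a ∷ (b ∷ as))  = (M ^ᴹ a) ⊗ N ⊗ word M N (b ∷ as)

module Submission where

-- Fix t = n + 1 and the selected position i, and write ι = toℕ i.  Put
--   M = I + e_ι e_{ι+1}ᵀ,   N = shift p ↦ p+1 with row ι deleted,
--   A = e_0 e_0ᵀ,          B = e_{n+1} e_{n+1}ᵀ,
-- all upper triangular.  Row ι of Mᵃ is e_ι + a·e_{ι+1}, every other row p of
-- Mᵃ is e_p; hence row p of MᵃN is e_{p+1} for p ≠ ι and row ι is a·e_{ι+2}.
-- Reading the word Mᵃ¹N⋯NMᵃᵗ from row 0, each block either advances one row
-- or, at row ι, jumps two rows picking up its exponent; the only way to reach
-- column n+1 is to jump exactly in block ι, so the (0, n+1) entry is a_ι, and
-- multiplying by A and B kills all other entries.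

open import Defs
open import Data.Nat using (ℕ; suc)
open import Data.Fin using (Fin)
open import Data.Vec using (Vec; lookup)
open import Data.Integer using (+_)
open import Data.Product using (Σ-syntax; _×_)
open import Relation.Binary.PropositionalEquality using (_≡_)

open import Data.Nat as ℕ using (zero; _≟_; _<_; _≤_; s≤s)
import Data.Nat.Properties as ℕP
open import Data.Integer using (ℤ; _+_; _*_; _-_; 0ℤ; 1ℤ)
open import Data.Integer.Properties
  using (+-*-semiring; +-identityˡ; +-identityʳ; *-identityˡ; *-identityʳ; *-zeroˡ; *-zeroʳ;
         *-assoc; *-comm)
open import Data.Integer.Tactic.RingSolver using (solve-∀)
open import Data.Fin using (zero; suc; toℕ; fromℕ; fromℕ<)
import Data.Fin.Properties as FP
open import Data.Vec using ([]; _∷_)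
open import Data.Product using (_,_)
open import Relation.Binary.PropositionalEquality
  using (refl; sym; trans; cong; cong₂; subst; _≢_; module ≡-Reasoning)
open import Relation.Nullary using (Dec; yes; no)
open import Data.Empty using (⊥-elim)
import Algebra.Properties.Semiring.Sum as SemiringSum

open ≡-Reasoning

-- Kronecker delta on ℕ; δ (toℕ s) v is the s-th entry of the unit vector e_v.
δ : ℕ → ℕ → ℤ
δ x y with x ≟ y
... | yes _ = 1ℤ
... | no _  = 0ℤ

δ-eq : ∀ {x y} → x ≡ y → δ x y ≡ 1ℤ
δ-eq {x} {y} x≡y with x ≟ y
... | yes _   = refl
... | no x≢y = ⊥-elim (x≢y x≡y)

δ-ne : ∀ {x y} → x ≢ y → δ x y ≡ 0ℤ
δ-ne {x} {y} x≢y with x ≟ y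
... | yes x≡y = ⊥-elim (x≢y x≡y)
... | no _    = refl

δ-< : ∀ {x y} → x < y → δ x y ≡ 0ℤ
δ-< x<y = δ-ne (ℕP.<⇒≢ x<y)

δ-suc : ∀ x y → δ (suc x) (suc y) ≡ δ x y
δ-suc x y with x ≟ y
... | yes x≡y = δ-eq (cong suc x≡y)
... | no x≢y  = δ-ne (λ e → x≢y (ℕP.suc-injective e))

I-δ : ∀ {k} (p r : Fin k) → I p r ≡ δ (toℕ r) (toℕ p)
I-δ zero    zero    = refl
I-δ zero    (suc r) = refl
I-δ (suc p) zero    = refl
I-δ (suc p) (suc r) = trans (I-δ p r) (sym (δ-suc (toℕ r) (toℕ p)))

E-δ : ∀ {k} (r c : Fin (suc k)) → E r c ≡ δ (toℕ r) 0 * δ (toℕ c) k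
E-δ {k} zero c with toℕ c ≟ k
... | yes _ = refl
... | no _  = refl
E-δ (suc r) c = refl

-- The sum Σ of Defs is the library's finite sum over the semiring ℤ, which
-- supplies congruence, additivity and scalar distributivity.
module ∑ = SemiringSum +-*-semiring

Σ≡sum : ∀ {k} (f : Fin k → ℤ) → Σ f ≡ ∑.sum f
Σ≡sum {zero}  f = refl
Σ≡sum {suc k} f = cong (_+_ (f zero)) (Σ≡sum (λ s → f (suc s)))

Σ-cong : ∀ {k} {f g : Fin k → ℤ} → (∀ s → f s ≡ g s) → Σ f ≡ Σ g
Σ-cong {f = f} {g} f≗g = trans (Σ≡sum f) (trans (∑.sum-cong-≗ f≗g) (sym (Σ≡sum g)))

Σ-+ : ∀ {k} (f g : Fin k → ℤ) → Σ (λ s → f s + g s) ≡ Σ f + Σ g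
Σ-+ f g = trans (Σ≡sum (λ s → f s + g s))
  (trans (∑.∑-distrib-+ f g) (sym (cong₂ _+_ (Σ≡sum f) (Σ≡sum g))))

Σ-* : ∀ {k} (c : ℤ) (f : Fin k → ℤ) → Σ (λ s → c * f s) ≡ c * Σ f
Σ-* c f = trans (Σ≡sum (λ s → c * f s)) (sym (trans (cong (c *_) (Σ≡sum f)) (∑.*-distribˡ-sum c f)))

Σ-sift : ∀ {k} (f : Fin k → ℤ) {q : Fin k} {v : ℕ} → toℕ q ≡ v →
         Σ (λ s → δ (toℕ s) v * f s) ≡ f q
Σ-sift {suc k} f {zero} refl = begin
  1ℤ * f zero + Σ (λ s → δ (suc (toℕ s)) 0 * f (suc s))
    ≡⟨ cong₂ _+_ (*-identityˡ (f zero)) (Σ-cong (λ s → cong (_* f (suc s)) (δ-ne {suc (toℕ s)} {0} (λ ())))) ⟩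
  f zero + Σ (λ s → 0ℤ * f (suc s))
    ≡⟨ cong (_+_ (f zero)) (trans (Σ-* 0ℤ (λ s → f (suc s))) (*-zeroˡ (Σ (λ s → f (suc s))))) ⟩
  f zero + 0ℤ
    ≡⟨ +-identityʳ (f zero) ⟩
  f zero ∎
Σ-sift {suc k} f {suc q} refl = begin
  δ 0 (suc (toℕ q)) * f zero + Σ (λ s → δ (suc (toℕ s)) (suc (toℕ q)) * f (suc s))
    ≡⟨ cong₂ _+_ (cong (_* f zero) (δ-ne {0} {suc (toℕ q)} (λ ())))
                 (Σ-cong (λ s → cong (_* f (suc s)) (δ-suc (toℕ s) (toℕ q)))) ⟩
  0ℤ * f zero + Σ (λ s → δ (toℕ s) (toℕ q) * f (suc s))
    ≡⟨ +-identityˡ _ ⟩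
  Σ (λ s → δ (toℕ s) (toℕ q) * f (suc s))
    ≡⟨ Σ-sift (λ s → f (suc s)) refl ⟩
  f (suc q) ∎

⊗-scaledRow : ∀ {k} {X Y : Mat k} {p q : Fin k} {v : ℕ} (c : ℤ) → toℕ q ≡ v →
              (∀ s → X p s ≡ c * δ (toℕ s) v) → ∀ j → (X ⊗ Y) p j ≡ c * Y q j
⊗-scaledRow {X = X} {Y} {p} {q} {v} c q≡v row j = begin
  Σ (λ s → X p s * Y s j)         ≡⟨ Σ-cong (λ s → trans (cong (_* Y s j) (row s)) (*-assoc c _ _)) ⟩
  Σ (λ s → c * (δ (toℕ s) v * Y s j)) ≡⟨ Σ-* c (λ s → δ (toℕ s) v * Y s j) ⟩
  c * Σ (λ s → δ (toℕ s) v * Y s j)   ≡⟨ cong (c *_) (Σ-sift (λ s → Y s j) q≡v) ⟩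
  c * Y q j ∎

⊗-unitRow : ∀ {k} {X Y : Mat k} {p q : Fin k} {v : ℕ} → toℕ q ≡ v →
            (∀ s → X p s ≡ δ (toℕ s) v) → ∀ j → (X ⊗ Y) p j ≡ Y q j
⊗-unitRow {X = X} {Y} {p} {q} q≡v row j =
  trans (⊗-scaledRow {X = X} {Y} {p} {q} 1ℤ q≡v (λ s → trans (row s) (sym (*-identityˡ _))) j) (*-identityˡ (Y q j))

⊗-twoRow : ∀ {k} {X Y : Mat k} {p q q′ : Fin k} {v w : ℕ} (c : ℤ) → toℕ q ≡ v → toℕ q′ ≡ w →
           (∀ s → X p s ≡ δ (toℕ s) v + c * δ (toℕ s) w) →
           ∀ j → (X ⊗ Y) p j ≡ Y q j + c * Y q′ j
⊗-twoRow {X = X} {Y} {p} {q} {q′} {v} {w} c q≡v q′≡w row j = begin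
  Σ (λ s → X p s * Y s j)
    ≡⟨ Σ-cong (λ s → trans (cong (_* Y s j) (row s)) (distrib (δ (toℕ s) v) c (δ (toℕ s) w) (Y s j))) ⟩
  Σ (λ s → δ (toℕ s) v * Y s j + c * (δ (toℕ s) w * Y s j))
    ≡⟨ Σ-+ (λ s → δ (toℕ s) v * Y s j) (λ s → c * (δ (toℕ s) w * Y s j)) ⟩
  Σ (λ s → δ (toℕ s) v * Y s j) + Σ (λ s → c * (δ (toℕ s) w * Y s j))
    ≡⟨ cong₂ _+_ (Σ-sift (λ s → Y s j) q≡v) (trans (Σ-* c (λ s → δ (toℕ s) w * Y s j)) (cong (c *_) (Σ-sift (λ s → Y s j) q′≡w))) ⟩
  Y q j + c * Y q′ j ∎
  where
  distrib : ∀ d c e y → (d + c * e) * y ≡ d * y + c * (e * y)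
  distrib = solve-∀

⊗-scaledCol : ∀ {k} {X Y : Mat k} {q j : Fin k} {v : ℕ} (c : ℤ) → toℕ q ≡ v →
              (∀ l → Y l j ≡ δ (toℕ l) v * c) → ∀ p → (X ⊗ Y) p j ≡ X p q * c
⊗-scaledCol {X = X} {Y} {q} {j} {v} c q≡v col p = begin
  Σ (λ l → X p l * Y l j)               ≡⟨ Σ-cong (λ l → trans (cong (X p l *_) (col l)) (swap (X p l) (δ (toℕ l) v) c)) ⟩
  Σ (λ l → c * (δ (toℕ l) v * X p l))    ≡⟨ Σ-* c (λ l → δ (toℕ l) v * X p l) ⟩
  c * Σ (λ l → δ (toℕ l) v * X p l)      ≡⟨ cong (c *_) (Σ-sift (X p) q≡v) ⟩
  c * X p q                              ≡⟨ *-comm c (X p q) ⟩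
  X p q * c ∎
  where
  swap : ∀ x d c → x * (d * c) ≡ c * (d * x)
  swap = solve-∀

≤-of-+ : ∀ {x y z} → x ℕ.+ y ≡ z → x ≤ z
≤-of-+ {x} eq = ℕP.m+n≤o⇒m≤o x (ℕP.≤-reflexive eq)

module Construction (n : ℕ) (i : Fin (suc n)) where

  ι : ℕ
  ι = toℕ i

  ι≤n : ι ≤ n
  ι≤n = FP.toℕ≤pred[n] i

  K : ℕ
  K = suc (suc n)

  M : Mat K
  M p s = δ (toℕ s) (toℕ p) + δ (toℕ p) ι * δ (toℕ s) (suc ι)

  N : Mat K
  N p s = (1ℤ - δ (toℕ p) ι) * δ (toℕ s) (suc (toℕ p))

  A : Mat K
  A r s = δ (toℕ r) 0 * δ (toℕ s) 0

  B : Mat K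
  B r s = δ (toℕ r) (suc n) * δ (toℕ s) (suc n)

  ι+1 : Fin K
  ι+1 = fromℕ< (s≤s (s≤s ι≤n))

  toℕ-ι+1 : toℕ ι+1 ≡ suc ι
  toℕ-ι+1 = FP.toℕ-fromℕ< (s≤s (s≤s ι≤n))

  ι+1≢ι : toℕ ι+1 ≢ ι
  ι+1≢ι e = ℕP.>⇒≢ (ℕP.n<1+n ι) (trans (sym toℕ-ι+1) e)

  last : Fin K
  last = fromℕ (suc n)

  toℕ-last : toℕ last ≡ suc n
  toℕ-last = FP.toℕ-fromℕ (suc n)

  N-off : ∀ {p} s → toℕ p ≢ ι → N p s ≡ δ (toℕ s) (suc (toℕ p))
  N-off {p} s p≢ι = trans (cong (λ d → (1ℤ - d) * δ (toℕ s) (suc (toℕ p))) (δ-ne p≢ι)) (*-identityˡ (δ (toℕ s) (suc (toℕ p))))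

  N-at : ∀ {p} s → toℕ p ≡ ι → N p s ≡ 0ℤ
  N-at {p} s p≡ι = trans (cong (λ d → (1ℤ - d) * δ (toℕ s) (suc (toℕ p))) (δ-eq p≡ι)) (*-zeroˡ (δ (toℕ s) (suc (toℕ p))))

  M-power : ∀ a (p r : Fin K) →
            (M ^ᴹ a) p r ≡ δ (toℕ r) (toℕ p) + + a * (δ (toℕ p) ι * δ (toℕ r) (suc ι))
  M-power zero p r = trans (I-δ p r) (sym (+-identityʳ (δ (toℕ r) (toℕ p))))
  M-power (suc a) p r = begin
    (M ⊗ M ^ᴹ a) p r
      ≡⟨ ⊗-twoRow {X = M} {M ^ᴹ a} (δ (toℕ p) ι) refl toℕ-ι+1 (λ s → refl) r ⟩
    (M ^ᴹ a) p r + at-ι * (M ^ᴹ a) ι+1 r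
      ≡⟨ cong₂ (λ x y → x + at-ι * y) (M-power a p r) (M-power a ι+1 r) ⟩
    diag + + a * (at-ι * e₊) + at-ι * (δ (toℕ r) (toℕ ι+1) + + a * (δ (toℕ ι+1) ι * e₊))
      ≡⟨ cong₂ (λ x y → diag + + a * (at-ι * e₊) + at-ι * (δ (toℕ r) x + + a * (y * e₊)))
               toℕ-ι+1 (δ-ne ι+1≢ι) ⟩
    diag + + a * (at-ι * e₊) + at-ι * (e₊ + + a * (0ℤ * e₊))
      ≡⟨ step diag (+ a) at-ι e₊ ⟩
    diag + + suc a * (at-ι * e₊) ∎
    where
    diag at-ι e₊ : ℤ
    diag = δ (toℕ r) (toℕ p)
    at-ι = δ (toℕ p) ι
    e₊ = δ (toℕ r) (suc ι)
    step : ∀ d a x e → d + a * (x * e) + x * (e + a * (0ℤ * e)) ≡ d + (1ℤ + a) * (x * e)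
    step = solve-∀

  M-power-off : ∀ a {p} r → toℕ p ≢ ι → (M ^ᴹ a) p r ≡ δ (toℕ r) (toℕ p)
  M-power-off a {p} r p≢ι = begin
    (M ^ᴹ a) p r                                              ≡⟨ M-power a p r ⟩
    δ (toℕ r) (toℕ p) + + a * (δ (toℕ p) ι * δ (toℕ r) (suc ι)) ≡⟨ cong (λ x → δ (toℕ r) (toℕ p) + + a * (x * δ (toℕ r) (suc ι))) (δ-ne p≢ι) ⟩
    δ (toℕ r) (toℕ p) + + a * 0ℤ                                ≡⟨ cong (_+_ (δ (toℕ r) (toℕ p))) (*-zeroʳ (+ a)) ⟩
    δ (toℕ r) (toℕ p) + 0ℤ                                      ≡⟨ +-identityʳ (δ (toℕ r) (toℕ p)) ⟩
    δ (toℕ r) (toℕ p) ∎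

  M-power-at : ∀ a {p} r → toℕ p ≡ ι → (M ^ᴹ a) p r ≡ δ (toℕ r) (toℕ p) + + a * δ (toℕ r) (suc ι)
  M-power-at a {p} r p≡ι = trans (M-power a p r)
    (cong (λ x → δ (toℕ r) (toℕ p) + + a * x)
          (trans (cong (_* δ (toℕ r) (suc ι)) (δ-eq p≡ι)) (*-identityˡ (δ (toℕ r) (suc ι)))))

  MN-row : ∀ a {p} → toℕ p ≢ ι → ∀ s → (M ^ᴹ a ⊗ N) p s ≡ δ (toℕ s) (suc (toℕ p))
  MN-row a p≢ι s = trans (⊗-unitRow {X = M ^ᴹ a} {N} refl (λ r → M-power-off a r p≢ι) s) (N-off s p≢ι)

  MN-row-at : ∀ a {p} → toℕ p ≡ ι → ∀ s → (M ^ᴹ a ⊗ N) p s ≡ + a * δ (toℕ s) (suc (suc ι))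
  MN-row-at a {p} p≡ι s = begin
    (M ^ᴹ a ⊗ N) p s                      ≡⟨ ⊗-twoRow {X = M ^ᴹ a} {N} (+ a) refl toℕ-ι+1 (λ r → M-power-at a r p≡ι) s ⟩
    N p s + + a * N ι+1 s                 ≡⟨ cong₂ (λ x y → x + + a * y) (N-at s p≡ι) (N-off s ι+1≢ι) ⟩
    0ℤ + + a * δ (toℕ s) (suc (toℕ ι+1))  ≡⟨ +-identityˡ _ ⟩
    + a * δ (toℕ s) (suc (toℕ ι+1))       ≡⟨ cong (λ x → + a * δ (toℕ s) (suc x)) toℕ-ι+1 ⟩
    + a * δ (toℕ s) (suc (suc ι)) ∎

  word-shift : ∀ {L} a (b : Vec ℕ (suc L)) {p q : Fin K} → toℕ p ≢ ι → toℕ q ≡ suc (toℕ p) →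
               ∀ j → word M N (a ∷ b) p j ≡ word M N b q j
  word-shift a b@(_ ∷ _) p≢ι q≡p+1 = ⊗-unitRow {X = M ^ᴹ a ⊗ N} {word M N b} q≡p+1 (MN-row a p≢ι)

  word-jump : ∀ {L} a (b : Vec ℕ (suc L)) {p q : Fin K} → toℕ p ≡ ι → toℕ q ≡ suc (suc ι) →
              ∀ j → word M N (a ∷ b) p j ≡ + a * word M N b q j
  word-jump a b@(_ ∷ _) p≡ι q≡ι+2 = ⊗-scaledRow {X = M ^ᴹ a ⊗ N} {word M N b} (+ a) q≡ι+2 (MN-row-at a p≡ι)

  next : (p : Fin K) → toℕ p ≤ n → Fin K
  next p p≤n = fromℕ< (s≤s (s≤s p≤n))

  toℕ-next : ∀ p (p≤n : toℕ p ≤ n) → toℕ (next p p≤n) ≡ suc (toℕ p)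
  toℕ-next p p≤n = FP.toℕ-fromℕ< (s≤s (s≤s p≤n))

  -- After the jump (row > ι, exactly L blocks left to reach row n+1) the
  -- remaining word contributes 1 to the last column.
  after-jump : ∀ L (b : Vec ℕ (suc L)) (p : Fin K) → ι < toℕ p → toℕ p ℕ.+ L ≡ suc n →
               word M N b p last ≡ 1ℤ
  after-jump zero (a ∷ []) p ι<p p+0≡n+1 =
    trans (M-power-off a last (ℕP.>⇒≢ ι<p))
          (δ-eq (trans toℕ-last (sym (trans (sym (ℕP.+-identityʳ (toℕ p))) p+0≡n+1))))
  after-jump (suc L) (a ∷ b) p ι<p p+L+1≡n+1 =
    trans (word-shift a b (ℕP.>⇒≢ ι<p) p′≡p+1 last)
          (after-jump L b p′ (subst (ι <_) (sym p′≡p+1) (ℕP.m<n⇒m<1+n ι<p))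
                      (trans (cong (ℕ._+ L) p′≡p+1) (trans (sym (ℕP.+-suc (toℕ p) L)) p+L+1≡n+1)))
    where
    p+L≡n : toℕ p ℕ.+ L ≡ n
    p+L≡n = ℕP.suc-injective (trans (sym (ℕP.+-suc (toℕ p) L)) p+L+1≡n+1)
    p′ : Fin K
    p′ = next p (≤-of-+ p+L≡n)
    p′≡p+1 : toℕ p′ ≡ suc (toℕ p)
    p′≡p+1 = toℕ-next p (≤-of-+ p+L≡n)

  -- Before the jump (row p with p + j = ι, L blocks left to reach row n) the
  -- word reads off the exponent of block j.
  before-jump : ∀ L (b : Vec ℕ (suc L)) (p : Fin K) (j : Fin (suc L)) →
                toℕ p ℕ.+ toℕ j ≡ ι → toℕ p ℕ.+ L ≡ n → word M N b p last ≡ + lookup b j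
  before-jump zero (a ∷ []) p zero p+0≡ι p+0≡n = begin
    (M ^ᴹ a) p last                                    ≡⟨ M-power-at a last p≡ι ⟩
    δ (toℕ last) (toℕ p) + + a * δ (toℕ last) (suc ι)  ≡⟨ cong₂ (λ x y → x + + a * y) (δ-ne last≢p) (δ-eq last≡ι+1) ⟩
    0ℤ + + a * 1ℤ                                      ≡⟨ trans (+-identityˡ (+ a * 1ℤ)) (*-identityʳ (+ a)) ⟩
    + a ∎
    where
    p≡ι : toℕ p ≡ ι
    p≡ι = trans (sym (ℕP.+-identityʳ (toℕ p))) p+0≡ι
    p≡n : toℕ p ≡ n
    p≡n = trans (sym (ℕP.+-identityʳ (toℕ p))) p+0≡n
    last≢p : toℕ last ≢ toℕ p
    last≢p e = ℕP.>⇒≢ (ℕP.n<1+n n) (trans (sym toℕ-last) (trans e p≡n))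
    last≡ι+1 : toℕ last ≡ suc ι
    last≡ι+1 = trans toℕ-last (cong suc (trans (sym p≡n) p≡ι))
  before-jump (suc L) (a ∷ b) p zero p+0≡ι p+L+1≡n =
    trans (word-jump a b p≡ι p′≡ι+2 last)
          (trans (cong (+ a *_) (after-jump L b p′ ι<p′ p′+L≡n+1)) (*-identityʳ (+ a)))
    where
    p≡ι : toℕ p ≡ ι
    p≡ι = trans (sym (ℕP.+-identityʳ (toℕ p))) p+0≡ι
    ι+1+L≡n : suc ι ℕ.+ L ≡ n
    ι+1+L≡n = trans (sym (ℕP.+-suc ι L)) (trans (cong (ℕ._+ suc L) (sym p≡ι)) p+L+1≡n)
    ι+1≤n : toℕ ι+1 ≤ n
    ι+1≤n = subst (_≤ n) (sym toℕ-ι+1) (≤-of-+ ι+1+L≡n)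
    p′ : Fin K
    p′ = next ι+1 ι+1≤n
    p′≡ι+2 : toℕ p′ ≡ suc (suc ι)
    p′≡ι+2 = trans (toℕ-next ι+1 ι+1≤n) (cong suc toℕ-ι+1)
    ι<p′ : ι < toℕ p′
    ι<p′ = subst (ι <_) (sym p′≡ι+2) (ℕP.m<n⇒m<1+n (ℕP.n<1+n ι))
    p′+L≡n+1 : toℕ p′ ℕ.+ L ≡ suc n
    p′+L≡n+1 = trans (cong (ℕ._+ L) p′≡ι+2) (cong suc ι+1+L≡n)
  before-jump (suc L) (a ∷ b) p (suc j) p+j+1≡ι p+L+1≡n =
    trans (word-shift a b p≢ι p′≡p+1 last)
          (before-jump L b p′ j (shifted (toℕ j) p+j+1≡ι) (shifted L p+L+1≡n))
    where
    p≢ι : toℕ p ≢ ι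
    p≢ι e = ℕP.<⇒≢ (ℕP.m<m+n (toℕ p) (s≤s ℕ.z≤n)) (trans e (sym p+j+1≡ι))
    p′ : Fin K
    p′ = next p (≤-of-+ p+L+1≡n)
    p′≡p+1 : toℕ p′ ≡ suc (toℕ p)
    p′≡p+1 = toℕ-next p (≤-of-+ p+L+1≡n)
    shifted : ∀ m {o} → toℕ p ℕ.+ suc m ≡ o → toℕ p′ ℕ.+ m ≡ o
    shifted m eq = trans (cong (ℕ._+ m) p′≡p+1) (trans (sym (ℕP.+-suc (toℕ p) m)) eq)

  sandwich : ∀ (W : Mat K) r c → (A ⊗ W ⊗ B) r c ≡ W zero last * (δ (toℕ r) 0 * δ (toℕ c) (suc n))
  sandwich W r c = begin
    (A ⊗ W ⊗ B) r c
      ≡⟨ ⊗-scaledCol {X = A ⊗ W} {B} {last} {c} (δ (toℕ c) (suc n)) toℕ-last (λ l → refl) r ⟩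
    (A ⊗ W) r last * δ (toℕ c) (suc n)
      ≡⟨ cong (_* δ (toℕ c) (suc n)) (⊗-scaledRow {X = A} {W} {r} {zero} (δ (toℕ r) 0) refl (λ s → refl) last) ⟩
    δ (toℕ r) 0 * W zero last * δ (toℕ c) (suc n)
      ≡⟨ rearrange (δ (toℕ r) 0) (W zero last) (δ (toℕ c) (suc n)) ⟩
    W zero last * (δ (toℕ r) 0 * δ (toℕ c) (suc n)) ∎
    where
    rearrange : ∀ x w y → x * w * y ≡ w * (x * y)
    rearrange = solve-∀

  product : (a : Vec ℕ (suc n)) → A ⊗ word M N a ⊗ B ≈ᴹ (+ lookup a i) ·ᴹ E
  product a r c = begin
    (A ⊗ word M N a ⊗ B) r c
      ≡⟨ sandwich (word M N a) r c ⟩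
    word M N a zero last * (δ (toℕ r) 0 * δ (toℕ c) (suc n))
      ≡⟨ cong₂ _*_ (before-jump n a zero i refl refl) (sym (E-δ r c)) ⟩
    + lookup a i * E r c ∎

  -- All four matrices are upper triangular: every delta δ (toℕ s) v in them
  -- has v ≥ the row index, or is multiplied by a factor vanishing below.
  A-upper : UpperTriangular A
  A-upper r s s<r = trans (cong (_* δ (toℕ s) 0) (δ-ne r≢0)) (*-zeroˡ (δ (toℕ s) 0))
    where
    r≢0 : toℕ r ≢ 0
    r≢0 e = ℕP.n≮0 (subst (toℕ s <_) e s<r)

  B-upper : UpperTriangular B
  B-upper r s s<r = trans (cong (δ (toℕ r) (suc n) *_) (δ-< (ℕP.<-≤-trans s<r (FP.toℕ≤pred[n] r))))
                          (*-zeroʳ (δ (toℕ r) (suc n)))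

  N-upper : UpperTriangular N
  N-upper r s s<r = trans (cong ((1ℤ - δ (toℕ r) ι) *_) (δ-< (ℕP.m<n⇒m<1+n s<r)))
                          (*-zeroʳ (1ℤ - δ (toℕ r) ι))

  M-upper : UpperTriangular M
  M-upper r s s<r = trans (cong₂ _+_ (δ-< s<r) (extra-vanishes (toℕ r ≟ ι))) (+-identityˡ 0ℤ)
    where
    extra-vanishes : Dec (toℕ r ≡ ι) → δ (toℕ r) ι * δ (toℕ s) (suc ι) ≡ 0ℤ
    extra-vanishes (yes r≡ι) =
      trans (cong (δ (toℕ r) ι *_) (δ-< (ℕP.m<n⇒m<1+n (subst (toℕ s <_) r≡ι s<r))))
            (*-zeroʳ (δ (toℕ r) ι))
    extra-vanishes (no r≢ι) = trans (cong (_* δ (toℕ s) (suc ι)) (δ-ne r≢ι)) (*-zeroˡ (δ (toℕ s) (suc ι)))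

lemma4 : (n : ℕ) (i : Fin (suc n)) →
    Σ[ m ∈ ℕ ] Σ[ A ∈ Mat (suc m) ] Σ[ M ∈ Mat (suc m) ] Σ[ N ∈ Mat (suc m) ] Σ[ B ∈ Mat (suc m) ]
      (UpperTriangular A × UpperTriangular M × UpperTriangular N × UpperTriangular B ×
       ((a : Vec ℕ (suc n)) → A ⊗ word M N a ⊗ B ≈ᴹ (+ lookup a i) ·ᴹ E))
lemma4 n i = suc n , A , M , N , B , A-upper , M-upper , N-upper , B-upper , product
  where open Construction n i
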